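{- For all incidence hypergraphs $G,H$ there are isomorphisms of multigraphs $U\left(\Upsilon^{\diamond}(G)\vec{\Box}\Upsilon^{\diamond}(H)\right)\cong U\Upsilon^{\diamond}(G)\Box U\Upsilon^{\diamond}(H)\cong U\Upsilon^{\diamond}(G\blacksquare H)$, natural in $G$ and $H$.
   Context: Incidence hypergraphs: $G=(\check V(G),\check E(G),I(G),\varsigma_G:I(G)\to\check V(G),\omega_G:I(G)\to\check E(G))$, homomorphisms are triples of functions commuting with $\varsigma,\omega$. Laplacian product: $\check V(G\blacksquare H)=(\{1\}\times\check V(G)\times\check V(H))\cup(\{4\}\times\check E(G)\times\check E(H))$, $\check E(G\blacksquare H)=(\{2\}\times\check E(G)\times\check V(H))\cup(\{3\}\times\check V(G)\times\check E(H))$, $I(G\blacksquare H)=(\{1\}\times I(G)\times\check V(H))\cup(\{2\}\times I(G)\times\check E(H))\cup(\{3\}\times\check E(G)\times I(H))\cup(\{4\}\times\check V(G)\times I(H))$, $\varsigma(1,x,y)=(1,\varsigma_G x,y)$, $\varsigma(2,x,y)=(4,\omega_G x,y)$, $\varsigma(3,x,y)=(4,x,\omega_H y)$, $\varsigma(4,x,y)=(1,x,\varsigma_H y)$, $\omega(1,x,y)=(2,\omega_G x,y)$, $\omega(2,x,y)=(3,\varsigma_G x,y)$, $\omega(3,x,y)=(2,x,\varsigma_H y)$, $\omega(4,x,y)=(3,x,\omega_H y)$; on morphisms componentwise. Quivers: $Q=(\vec V(Q),\vec E(Q),\sigma_Q,\tau_Q)$ with source and target maps $\vec E(Q)\to\vec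 V(Q)$; homomorphisms preserve source and target. Quiver box product: $\vec V(Q\vec\Box P)=\vec V(Q)\times\vec V(P)$, $\vec E(Q\vec\Box P)=(\{1\}\times\vec E(Q)\times\vec V(P))\cup(\{2\}\times\vec V(Q)\times\vec E(P))$, $\sigma(1,x,y)=(\sigma_Q x,y)$, $\sigma(2,x,y)=(x,\sigma_P y)$, $\tau$ analogously. $\Upsilon^\diamond:\mathfrak R\to$ quivers: $\vec V(\Upsilon^\diamond G)=(\{1\}\times\check V(G))\cup(\{2\}\times\check E(G))$, $\vec E(\Upsilon^\diamond G)=I(G)$, $\sigma(i)=(1,\varsigma_G i)$, $\tau(i)=(2,\omega_G i)$. Multigraphs: $(V,E,\epsilon:E\to\mathcal PV)$ with $1\le|\epsilon(e)|\le2$; homomorphisms $(V\phi,E\phi)$ with $\epsilon_H(E\phi(e))=V\phi[\epsilon_G(e)]$. $U$ (undirecting): $U(Q)=(\vec V(Q),\vec E(Q),e\mapsto\{\sigma_Q e,\tau_Q e\})$. Multigraph box product: $V(G\Box H)=V(G)\times V(H)$, $E(G\Box H)=(\{1\}\times E(G)\times V(H))\cup(\{2\}\times V(G)\times E(H))$, $\epsilon(1,x,y)=\epsilon_G(x)\times\{y\}$, $\epsilon(2,x,y)=\{x\}\times\epsilon_H(y)$. -}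

module Defs where

open import Data.Product using (Σ; _×_; _,_; proj₁; proj₂)
open import Data.Sum using (_⊎_; inj₁; inj₂)
open import Relation.Binary.PropositionalEquality using (_≡_; refl; sym; trans; cong; cong₂)

record Hyp : Set₁ where
  field
    V : Set
    E : Set
    I : Set
    ς : I → V
    ω : I → E
open Hyp

record HypHom (G H : Hyp) : Set where
  field
    hV : V G → V H
    hE : E G → E H
    hI : I G → I H
    hς : ∀ i → ς H (hI i) ≡ hV (ς G i)
    hω : ∀ i → ω H (hI i) ≡ hE (ω G i)
open HypHom

-- Laplacian product  G ■ H  (tags 1..4 as in the paper)

data LV (G H : Hyp) : Set where
  lv1 : V G → V H → LV G H
  lv4 : E G → E H → LV G H

data LE (G H : Hyp) : Set where
  le2 : E G → V H → LE G H
  le3 : V G → E H → LE G H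

data LI (G H : Hyp) : Set where
  li1 : I G → V H → LI G H
  li2 : I G → E H → LI G H
  li3 : E G → I H → LI G H
  li4 : V G → I H → LI G H

Lς : (G H : Hyp) → LI G H → LV G H
Lς G H (li1 x y) = lv1 (ς G x) y
Lς G H (li2 x y) = lv4 (ω G x) y
Lς G H (li3 x y) = lv4 x (ω H y)
Lς G H (li4 x y) = lv1 x (ς H y)

Lω : (G H : Hyp) → LI G H → LE G H
Lω G H (li1 x y) = le2 (ω G x) y
Lω G H (li2 x y) = le3 (ς G x) y
Lω G H (li3 x y) = le2 x (ς H y)
Lω G H (li4 x y) = le3 x (ω H y)

_■_ : Hyp → Hyp → Hyp
G ■ H = record { V = LV G H ; E = LE G H ; I = LI G H ; ς = Lς G H ; ω = Lω G H }

module _ {G G' H H' : Hyp} (f : HypHom G G') (g : HypHom H H') where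
  ■V : LV G H → LV G' H'
  ■V (lv1 x y) = lv1 (hV f x) (hV g y)
  ■V (lv4 x y) = lv4 (hE f x) (hE g y)

  ■E : LE G H → LE G' H'
  ■E (le2 x y) = le2 (hE f x) (hV g y)
  ■E (le3 x y) = le3 (hV f x) (hE g y)

  ■I : LI G H → LI G' H'
  ■I (li1 x y) = li1 (hI f x) (hV g y)
  ■I (li2 x y) = li2 (hI f x) (hE g y)
  ■I (li3 x y) = li3 (hE f x) (hI g y)
  ■I (li4 x y) = li4 (hV f x) (hI g y)

  ■ς : ∀ i → Lς G' H' (■I i) ≡ ■V (Lς G H i)
  ■ς (li1 x y) = cong (λ z → lv1 z (hV g y)) (hς f x)
  ■ς (li2 x y) = cong (λ z → lv4 z (hE g y)) (hω f x)
  ■ς (li3 x y) = cong (lv4 (hE f x)) (hω g y)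
  ■ς (li4 x y) = cong (lv1 (hV f x)) (hς g y)

  ■ω : ∀ i → Lω G' H' (■I i) ≡ ■E (Lω G H i)
  ■ω (li1 x y) = cong (λ z → le2 z (hV g y)) (hω f x)
  ■ω (li2 x y) = cong (λ z → le3 z (hE g y)) (hς f x)
  ■ω (li3 x y) = cong (le2 (hE f x)) (hς g y)
  ■ω (li4 x y) = cong (le3 (hV f x)) (hω g y)

_■₁_ : {G G' H H' : Hyp} → HypHom G G' → HypHom H H' → HypHom (G ■ H) (G' ■ H')
f ■₁ g = record { hV = ■V f g ; hE = ■E f g ; hI = ■I f g ; hς = ■ς f g ; hω = ■ω f g }

record Quiver : Set₁ where
  field
    QV : Set
    QE : Set
    σ  : QE → QV
    τ  : QE → QV
open Quiver

record QuiverHom (Q P : Quiver) : Set where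
  field
    qV : QV Q → QV P
    qE : QE Q → QE P
    qσ : ∀ e → σ P (qE e) ≡ qV (σ Q e)
    qτ : ∀ e → τ P (qE e) ≡ qV (τ Q e)
open QuiverHom

data BE (Q P : Quiver) : Set where
  be1 : QE Q → QV P → BE Q P
  be2 : QV Q → QE P → BE Q P

Bσ : (Q P : Quiver) → BE Q P → QV Q × QV P
Bσ Q P (be1 x y) = σ Q x , y
Bσ Q P (be2 x y) = x , σ P y

Bτ : (Q P : Quiver) → BE Q P → QV Q × QV P
Bτ Q P (be1 x y) = τ Q x , y
Bτ Q P (be2 x y) = x , τ P y

_□⃗_ : Quiver → Quiver → Quiver
Q □⃗ P = record { QV = QV Q × QV P ; QE = BE Q P ; σ = Bσ Q P ; τ = Bτ Q P }

module _ {Q Q' P P' : Quiver} (f : QuiverHom Q Q') (g : QuiverHom P P') where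
  □⃗V : QV Q × QV P → QV Q' × QV P'
  □⃗V (x , y) = qV f x , qV g y

  □⃗E : BE Q P → BE Q' P'
  □⃗E (be1 x y) = be1 (qE f x) (qV g y)
  □⃗E (be2 x y) = be2 (qV f x) (qE g y)

  □⃗σ : ∀ e → Bσ Q' P' (□⃗E e) ≡ □⃗V (Bσ Q P e)
  □⃗σ (be1 x y) = cong (λ z → z , qV g y) (qσ f x)
  □⃗σ (be2 x y) = cong (qV f x ,_) (qσ g y)

  □⃗τ : ∀ e → Bτ Q' P' (□⃗E e) ≡ □⃗V (Bτ Q P e)
  □⃗τ (be1 x y) = cong (λ z → z , qV g y) (qτ f x)
  □⃗τ (be2 x y) = cong (qV f x ,_) (qτ g y)

_□⃗₁_ : {Q Q' P P' : Quiver} → QuiverHom Q Q' → QuiverHom P P' → QuiverHom (Q □⃗ P) (Q' □⃗ P')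
f □⃗₁ g = record { qV = □⃗V f g ; qE = □⃗E f g ; qσ = □⃗σ f g ; qτ = □⃗τ f g }

-- Υ^⋄ : incidence hypergraphs → quivers  (tag 1 = inj₁, tag 2 = inj₂)

Υ : Hyp → Quiver
Υ G = record { QV = V G ⊎ E G ; QE = I G ; σ = λ i → inj₁ (ς G i) ; τ = λ i → inj₂ (ω G i) }

ΥV : {G H : Hyp} → HypHom G H → V G ⊎ E G → V H ⊎ E H
ΥV f (inj₁ v) = inj₁ (hV f v)
ΥV f (inj₂ e) = inj₂ (hE f e)

Υ₁ : {G H : Hyp} → HypHom G H → QuiverHom (Υ G) (Υ H)
Υ₁ f = record { qV = ΥV f ; qE = hI f
              ; qσ = λ i → cong inj₁ (hς f i) ; qτ = λ i → cong inj₂ (hω f i) }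

-- Each edge e has an endpoint set ε(e) ⊆ V with 1 ≤ |ε(e)| ≤ 2;
-- we present it as the set {a , b} of a chosen pair (a , b) = ends e
-- (a = b for loops).

Subset : Set → Set₁
Subset A = A → Set

Pair : {A : Set} → A → A → Subset A
Pair a b w = (w ≡ a) ⊎ (w ≡ b)

Img : {A B : Set} → (A → B) → Subset A → Subset B
Img {A} f S w = Σ A (λ v → S v × (f v ≡ w))

SetEq : {A : Set} → Subset A → Subset A → Set
SetEq {A} S T = ∀ w → (S w → T w) × (T w → S w)

record Multigraph : Set₁ where
  field
    MV   : Set
    ME   : Set
    ends : ME → MV × MV
open Multigraph

ε : (G : Multigraph) → ME G → Subset (MV G)
ε G e = Pair (proj₁ (ends G e)) (proj₂ (ends G e))

record MHom (G H : Multigraph) : Set where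
  field
    mV  : MV G → MV H
    mE  : ME G → ME H
    hom : ∀ e → SetEq (ε H (mE e)) (Img mV (ε G e))
open MHom public

record MIso (G H : Multigraph) : Set where
  field
    to     : MHom G H
    from   : MHom H G
    invV₁  : ∀ v → mV from (mV to v) ≡ v
    invV₂  : ∀ v → mV to (mV from v) ≡ v
    invE₁  : ∀ e → mE from (mE to e) ≡ e
    invE₂  : ∀ e → mE to (mE from e) ≡ e
open MIso public

Square : {A B A' B' : Multigraph} → MHom A B → MHom A' B' → MHom A A' → MHom B B' → Set
Square α α' F F' =
  (∀ v → mV F' (mV α v) ≡ mV α' (mV F v)) × (∀ e → mE F' (mE α e) ≡ mE α' (mE F e))

pairLemma : {A B : Set} (f : A → B) {a b : A} {c d : B} →
            c ≡ f a → d ≡ f b → SetEq (Pair c d) (Img f (Pair a b))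
pairLemma f refl refl w =
  (λ { (inj₁ refl) → _ , inj₁ refl , refl ; (inj₂ refl) → _ , inj₂ refl , refl }) ,
  (λ { (v , inj₁ refl , refl) → inj₁ refl ; (v , inj₂ refl , refl) → inj₂ refl })

U : Quiver → Multigraph
U Q = record { MV = QV Q ; ME = QE Q ; ends = λ e → σ Q e , τ Q e }

U₁ : {Q P : Quiver} → QuiverHom Q P → MHom (U Q) (U P)
U₁ f = record { mV = qV f ; mE = qE f ; hom = λ e → pairLemma (qV f) (qσ f e) (qτ f e) }

data ME□ (G H : Multigraph) : Set where
  me1 : ME G → MV H → ME□ G H
  me2 : MV G → ME H → ME□ G H

ends□ : (G H : Multigraph) → ME□ G H → (MV G × MV H) × (MV G × MV H)
ends□ G H (me1 x y) = (proj₁ (ends G x) , y) , (proj₂ (ends G x) , y)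
ends□ G H (me2 x y) = (x , proj₁ (ends H y)) , (x , proj₂ (ends H y))

_□_ : Multigraph → Multigraph → Multigraph
G □ H = record { MV = MV G × MV H ; ME = ME□ G H ; ends = ends□ G H }

private
  prodL : {A B C D : Set} (f : A → C) (g : B → D) {a b : A} {c d : C} (y : B) →
          SetEq (Pair c d) (Img f (Pair a b)) →
          SetEq (Pair (c , g y) (d , g y))
                (Img (λ p → f (proj₁ p) , g (proj₂ p)) (Pair (a , y) (b , y)))
  prodL f g y h w = to' , from'
    where
    lift : ∀ {x} → Img f (Pair _ _) x → Img _ (Pair _ _) (x , g y)
    lift (v , inj₁ refl , refl) = _ , inj₁ refl , refl
    lift (v , inj₂ refl , refl) = _ , inj₂ refl , refl
    to' : _
    to' (inj₁ refl) = lift (proj₁ (h _) (inj₁ refl))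
    to' (inj₂ refl) = lift (proj₁ (h _) (inj₂ refl))
    back : ∀ {x} → Pair _ _ x → Pair _ _ (x , g y)
    back (inj₁ refl) = inj₁ refl
    back (inj₂ refl) = inj₂ refl
    from' : _
    from' (v , inj₁ refl , refl) = back (proj₂ (h _) (_ , inj₁ refl , refl))
    from' (v , inj₂ refl , refl) = back (proj₂ (h _) (_ , inj₂ refl , refl))

  prodR : {A B C D : Set} (f : A → C) (g : B → D) {a b : B} {c d : D} (x : A) →
          SetEq (Pair c d) (Img g (Pair a b)) →
          SetEq (Pair (f x , c) (f x , d))
                (Img (λ p → f (proj₁ p) , g (proj₂ p)) (Pair (x , a) (x , b)))
  prodR f g x h w = to' , from'
    where
    lift : ∀ {y} → Img g (Pair _ _) y → Img _ (Pair _ _) (f x , y)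
    lift (v , inj₁ refl , refl) = _ , inj₁ refl , refl
    lift (v , inj₂ refl , refl) = _ , inj₂ refl , refl
    to' : _
    to' (inj₁ refl) = lift (proj₁ (h _) (inj₁ refl))
    to' (inj₂ refl) = lift (proj₁ (h _) (inj₂ refl))
    back : ∀ {y} → Pair _ _ y → Pair _ _ (f x , y)
    back (inj₁ refl) = inj₁ refl
    back (inj₂ refl) = inj₂ refl
    from' : _
    from' (v , inj₁ refl , refl) = back (proj₂ (h _) (_ , inj₁ refl , refl))
    from' (v , inj₂ refl , refl) = back (proj₂ (h _) (_ , inj₂ refl , refl))

module _ {G G' H H' : Multigraph} (f : MHom G G') (g : MHom H H') where
  □V : MV G × MV H → MV G' × MV H'
  □V p = mV f (proj₁ p) , mV g (proj₂ p)

  □E : ME□ G H → ME□ G' H'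
  □E (me1 x y) = me1 (mE f x) (mV g y)
  □E (me2 x y) = me2 (mV f x) (mE g y)

  □hom : ∀ e → SetEq (ε (G' □ H') (□E e)) (Img □V (ε (G □ H) e))
  □hom (me1 x y) = prodL (mV f) (mV g) y (hom f x)
  □hom (me2 x y) = prodR (mV f) (mV g) x (hom g y)

_□₁_ : {G G' H H' : Multigraph} → MHom G G' → MHom H H' → MHom (G □ H) (G' □ H')
f □₁ g = record { mV = □V f g ; mE = □E f g ; hom = □hom f g }

-- Both isomorphisms are bijective relabellings.  The first is the identity on
-- vertices: the two box products have the same edges with the same ends.  For the
-- second, a vertex (p , q) of UΥG □ UΥH with p, q of equal kind becomes a vertex
-- of Υ(G ■ H) (tags 1, 4) and one of mixed kind an edge (tags 2, 3).  The
-- Laplacian product reverses the orientation of the incidences tagged 2 and 3,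
-- which U forgets, since an endpoint set {a , b} does not record the order.
module Submission where

open import Defs
open Multigraph using (MV; ME)
open import Data.Product using (Σ; _×_; _,_)
open import Data.Sum using (inj₁; inj₂)
open import Function using (id)
open import Relation.Binary.PropositionalEquality using (_≡_; refl)

Pair-swap-image : {A B : Set} (f : A → B) {a b : A} →
                  SetEq (Pair (f b) (f a)) (Img f (Pair a b))
Pair-swap-image f w =
  (λ { (inj₁ refl) → _ , inj₂ refl , refl ; (inj₂ refl) → _ , inj₁ refl , refl }) ,
  (λ { (v , inj₁ refl , refl) → inj₂ refl ; (v , inj₂ refl , refl) → inj₁ refl })

Pair-image : {A B : Set} (f : A → B) {a b : A} →
             SetEq (Pair (f a) (f b)) (Img f (Pair a b))
Pair-image f = pairLemma f refl refl

module U-□⃗ (Q P : Quiver) where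

  toE : BE Q P → ME□ (U Q) (U P)
  toE (be1 x y) = me1 x y
  toE (be2 x y) = me2 x y

  fromE : ME□ (U Q) (U P) → BE Q P
  fromE (me1 x y) = be1 x y
  fromE (me2 x y) = be2 x y

  to-hom : MHom (U (Q □⃗ P)) (U Q □ U P)
  to-hom = record { mV = id ; mE = toE ; hom = λ { (be1 x y) → Pair-image id
                                                 ; (be2 x y) → Pair-image id } }

  from-hom : MHom (U Q □ U P) (U (Q □⃗ P))
  from-hom = record { mV = id ; mE = fromE ; hom = λ { (me1 x y) → Pair-image id
                                                     ; (me2 x y) → Pair-image id } }

  iso : MIso (U (Q □⃗ P)) (U Q □ U P)
  iso = record
    { to = to-hom ; from = from-hom
    ; invV₁ = λ _ → refl ; invV₂ = λ _ → refl
    ; invE₁ = λ { (be1 x y) → refl ; (be2 x y) → refl }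
    ; invE₂ = λ { (me1 x y) → refl ; (me2 x y) → refl } }

U-□⃗-natural : {Q Q' P P' : Quiver} (f : QuiverHom Q Q') (g : QuiverHom P P') →
              Square (U-□⃗.to-hom Q P) (U-□⃗.to-hom Q' P') (U₁ (f □⃗₁ g)) (U₁ f □₁ U₁ g)
U-□⃗-natural f g = (λ { (x , y) → refl }) , (λ { (be1 x y) → refl ; (be2 x y) → refl })

module UΥ-■ (G H : Hyp) where

  S = U (Υ G) □ U (Υ H)
  T = U (Υ (G ■ H))

  toV : MV S → MV T
  toV (inj₁ v , inj₁ w) = inj₁ (lv1 v w)
  toV (inj₂ e , inj₂ f) = inj₁ (lv4 e f)
  toV (inj₂ e , inj₁ w) = inj₂ (le2 e w)
  toV (inj₁ v , inj₂ f) = inj₂ (le3 v f)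

  fromV : MV T → MV S
  fromV (inj₁ (lv1 v w)) = inj₁ v , inj₁ w
  fromV (inj₁ (lv4 e f)) = inj₂ e , inj₂ f
  fromV (inj₂ (le2 e w)) = inj₂ e , inj₁ w
  fromV (inj₂ (le3 v f)) = inj₁ v , inj₂ f

  toE : ME S → ME T
  toE (me1 i (inj₁ w)) = li1 i w
  toE (me1 i (inj₂ f)) = li2 i f
  toE (me2 (inj₂ e) j) = li3 e j
  toE (me2 (inj₁ v) j) = li4 v j

  fromE : ME T → ME S
  fromE (li1 i w) = me1 i (inj₁ w)
  fromE (li2 i f) = me1 i (inj₂ f)
  fromE (li3 e j) = me2 (inj₂ e) j
  fromE (li4 v j) = me2 (inj₁ v) j

  to-hom : MHom S T
  to-hom = record { mV = toV ; mE = toE ; hom = λ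
    { (me1 i (inj₁ w)) → Pair-image toV
    ; (me1 i (inj₂ f)) → Pair-swap-image toV
    ; (me2 (inj₂ e) j) → Pair-swap-image toV
    ; (me2 (inj₁ v) j) → Pair-image toV } }

  from-hom : MHom T S
  from-hom = record { mV = fromV ; mE = fromE ; hom = λ
    { (li1 i w) → Pair-image fromV
    ; (li2 i f) → Pair-swap-image fromV
    ; (li3 e j) → Pair-swap-image fromV
    ; (li4 v j) → Pair-image fromV } }

  fromV∘toV : ∀ v → fromV (toV v) ≡ v
  fromV∘toV (inj₁ v , inj₁ w) = refl
  fromV∘toV (inj₂ e , inj₂ f) = refl
  fromV∘toV (inj₂ e , inj₁ w) = refl
  fromV∘toV (inj₁ v , inj₂ f) = refl

  toV∘fromV : ∀ v → toV (fromV v) ≡ v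
  toV∘fromV (inj₁ (lv1 v w)) = refl
  toV∘fromV (inj₁ (lv4 e f)) = refl
  toV∘fromV (inj₂ (le2 e w)) = refl
  toV∘fromV (inj₂ (le3 v f)) = refl

  fromE∘toE : ∀ e → fromE (toE e) ≡ e
  fromE∘toE (me1 i (inj₁ w)) = refl
  fromE∘toE (me1 i (inj₂ f)) = refl
  fromE∘toE (me2 (inj₂ e) j) = refl
  fromE∘toE (me2 (inj₁ v) j) = refl

  toE∘fromE : ∀ e → toE (fromE e) ≡ e
  toE∘fromE (li1 i w) = refl
  toE∘fromE (li2 i f) = refl
  toE∘fromE (li3 e j) = refl
  toE∘fromE (li4 v j) = refl

  iso : MIso S T
  iso = record
    { to = to-hom ; from = from-hom
    ; invV₁ = fromV∘toV ; invV₂ = toV∘fromV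
    ; invE₁ = fromE∘toE ; invE₂ = toE∘fromE }

UΥ-■-natural : {G G' H H' : Hyp} (f : HypHom G G') (g : HypHom H H') →
               Square (UΥ-■.to-hom G H) (UΥ-■.to-hom G' H')
                      (U₁ (Υ₁ f) □₁ U₁ (Υ₁ g)) (U₁ (Υ₁ (f ■₁ g)))
UΥ-■-natural {G} {G'} {H} {H'} f g = natV , natE
  where
  open UΥ-■ using (toV; toE)

  natV : ∀ v → ΥV (f ■₁ g) (toV G H v) ≡ toV G' H' (□V (U₁ (Υ₁ f)) (U₁ (Υ₁ g)) v)
  natV (inj₁ v , inj₁ w) = refl
  natV (inj₂ e , inj₂ f) = refl
  natV (inj₂ e , inj₁ w) = refl
  natV (inj₁ v , inj₂ f) = refl

  natE : ∀ e → ■I f g (toE G H e) ≡ toE G' H' (□E (U₁ (Υ₁ f)) (U₁ (Υ₁ g)) e)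
  natE (me1 i (inj₁ w)) = refl
  natE (me1 i (inj₂ f)) = refl
  natE (me2 (inj₂ e) j) = refl
  natE (me2 (inj₁ v) j) = refl

mainTheorem6 :
    Σ ((G H : Hyp) → MIso (U (Υ G □⃗ Υ H)) (U (Υ G) □ U (Υ H))) λ α →
    Σ ((G H : Hyp) → MIso (U (Υ G) □ U (Υ H)) (U (Υ (G ■ H)))) λ β →
      (∀ {G G' H H' : Hyp} (f : HypHom G G') (g : HypHom H H') →
         Square (to (α G H)) (to (α G' H'))
                (U₁ (Υ₁ f □⃗₁ Υ₁ g)) (U₁ (Υ₁ f) □₁ U₁ (Υ₁ g)))
      ×
      (∀ {G G' H H' : Hyp} (f : HypHom G G') (g : HypHom H H') →
         Square (to (β G H)) (to (β G' H'))
                (U₁ (Υ₁ f) □₁ U₁ (Υ₁ g)) (U₁ (Υ₁ (f ■₁ g))))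
mainTheorem6 =
  (λ G H → U-□⃗.iso (Υ G) (Υ H)) ,
  UΥ-■.iso ,
  (λ f g → U-□⃗-natural (Υ₁ f) (Υ₁ g)) ,
  UΥ-■-natural
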